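{- Let $N\subset\mathfrak{h}^1[t]$ be a differential submodule, $\mathfrak{A}$ a $\mathbb{Q}$-algebra and $\alpha\in\mathfrak{A}$. Then the $\mathfrak{A}[t]$-module $\mathfrak{A}\otimes_{\mathbb{Q}}N$ is generated by the $\mathfrak{A}$-submodule $N_\alpha=\{f(\alpha)\mid f(t)\in\mathfrak{A}\otimes_{\mathbb{Q}}N\}\subset\mathfrak{A}\otimes_{\mathbb{Q}}\mathfrak{h}^1$.
   Context: $\mathfrak{h}^1=\mathbb{Q}\langle z_1,z_2,\ldots\rangle$ is the non-commutative polynomial algebra over $\mathbb{Q}$ on letters $z_k$ ($k\geq 1$), and $\mathfrak{h}^1[t]$ is its polynomial extension in an indeterminate $t$. A $\mathbb{Q}[t]$-submodule $N$ of $\mathfrak{h}^1[t]$ is called a differential submodule if $f(t)\in N$ implies $\frac{df}{dt}(t)\in N$. -}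

module Defs where

open import Level using (Level; _⊔_; 0ℓ) renaming (suc to lsuc)
open import Algebra.Bundles using (CommutativeRing)
open import Algebra.Morphism.Structures using (module RingMorphisms)
open import Data.List using (List; []; _∷_; map; concatMap; _++_)
open import Data.List.Properties using (≡-dec)
open import Data.List.Relation.Unary.All using (All)
open import Data.Nat as ℕ using (ℕ; zero; suc; _∸_)
open import Data.Product using (_×_; _,_; Σ; proj₁; proj₂)
open import Data.Rational using (ℚ)
open import Data.Rational.Properties using (+-*-commutativeRing)
open import Relation.Nullary using (yes; no)

-- A word in the letters z_1, z_2, ... ; the entry n stands for the letter z_(n+1).
Word : Set
Word = List ℕ

-- Polynomials with coefficients in a commutative ring R, represented as finite
-- formal sums of terms, compared by their coefficient functions.
module Poly {c ℓ} (R : CommutativeRing c ℓ) where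
  open CommutativeRing R

  -- R ⊗ h¹  =  R⟨z_1, z_2, ...⟩ : finite sums of (coefficient , word)
  NC : Set c
  NC = List (Carrier × Word)

  -- R ⊗ h¹[t] : finite sums of  a · w · t^k
  NCt : Set c
  NCt = List (Carrier × Word × ℕ)

  -- R[t] : finite sums of  a · t^k
  Pol : Set c
  Pol = List (Carrier × ℕ)

  pow : Carrier → ℕ → Carrier
  pow a zero = 1#
  pow a (suc n) = a * pow a n

  natMul : ℕ → Carrier → Carrier
  natMul zero a = 0#
  natMul (suc n) a = a + natMul n a

  coeffNC : NC → Word → Carrier
  coeffNC [] w = 0#
  coeffNC ((a , v) ∷ f) w with ≡-dec ℕ._≟_ v w
  ... | yes _ = a + coeffNC f w
  ... | no _ = coeffNC f w

  coeff : NCt → Word → ℕ → Carrier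
  coeff [] w k = 0#
  coeff ((a , v , j) ∷ f) w k with ≡-dec ℕ._≟_ v w | j ℕ.≟ k
  ... | yes _ | yes _ = a + coeff f w k
  ... | _ | _ = coeff f w k

  _≋NC_ : NC → NC → Set ℓ
  f ≋NC g = ∀ w → coeffNC f w ≈ coeffNC g w

  _≋_ : NCt → NCt → Set ℓ
  f ≋ g = ∀ w k → coeff f w k ≈ coeff g w k

  _⊕_ : NCt → NCt → NCt
  f ⊕ g = f ++ g

  sumNCt : List NCt → NCt
  sumNCt [] = []
  sumNCt (f ∷ fs) = f ⊕ sumNCt fs

  _·_ : Pol → NCt → NCt
  p · f = concatMap (λ bj → map (λ awk → (proj₁ bj * proj₁ awk , proj₁ (proj₂ awk) , proj₂ bj ℕ.+ proj₂ (proj₂ awk))) f) p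

  deriv : NCt → NCt
  deriv f = map (λ awk → (natMul (proj₂ (proj₂ awk)) (proj₁ awk) , proj₁ (proj₂ awk) , proj₂ (proj₂ awk) ∸ 1)) f

  eval : Carrier → NCt → NC
  eval α f = map (λ awk → (proj₁ awk * pow α (proj₂ (proj₂ awk)) , proj₁ (proj₂ awk))) f

  const : NC → NCt
  const x = map (λ aw → (proj₁ aw , proj₂ aw , 0)) x

  -- M (a predicate on R ⊗ h¹[t]) is the R[t]-module generated by S ⊂ R ⊗ h¹:
  -- S ⊂ M and every element of M is an R[t]-linear combination of elements of S.
  GeneratedBy : ∀ {s m} → (NC → Set s) → (NCt → Set m) → Set (c ⊔ ℓ ⊔ s ⊔ m)
  GeneratedBy S M =
    ((x : NC) → S x → M (const x)) ×
    ((f : NCt) → M f →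
      Σ (List (Pol × NC)) λ gs →
        All (λ px → S (proj₂ px)) gs ×
        (f ≋ sumNCt (map (λ px → proj₁ px · const (proj₂ px)) gs)))

module Q = Poly +-*-commutativeRing

record IsDiffSubmodule {n} (N : Q.NCt → Set n) : Set n where
  field
    respects : ∀ {f g} → f Q.≋ g → N f → N g
    zeroMem  : N []
    addMem   : ∀ {f g} → N f → N g → N (f Q.⊕ g)
    smulMem  : ∀ (p : Q.Pol) {f} → N f → N (p Q.· f)
    derivMem : ∀ {f} → N f → N (Q.deriv f)

-- ℚ-algebras: a commutative ring A together with a ring homomorphism ℚ → A
IsQAlgebraStr : ∀ {c ℓ} (A : CommutativeRing c ℓ) → (ℚ → CommutativeRing.Carrier A) → Set ℓ
IsQAlgebraStr A φ = RingMorphisms.IsRingHomomorphism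
  (CommutativeRing.rawRing +-*-commutativeRing) (CommutativeRing.rawRing A) φ

module Base {c ℓ} (A : CommutativeRing c ℓ) (φ : ℚ → CommutativeRing.Carrier A) where
  open CommutativeRing A using (Carrier)
  open Poly A

  -- base change  h¹[t] → A ⊗ h¹[t] ,  f ↦ 1 ⊗ f
  ι : Q.NCt → NCt
  ι f = map (λ qwk → (φ (proj₁ qwk) , proj₂ qwk)) f

  -- A ⊗_ℚ N, realised as its (isomorphic, ℚ being a field) image in A ⊗ h¹[t]:
  -- the A-span of 1 ⊗ N.
  Tensor : ∀ {n} → (Q.NCt → Set n) → NCt → Set (c ⊔ ℓ ⊔ n)
  Tensor N f = Σ (List (Carrier × Q.NCt)) λ gs →
    All (λ ag → N (proj₂ ag)) gs ×
    (f ≋ sumNCt (map (λ ag → ((proj₁ ag , 0) ∷ []) · ι (proj₂ ag)) gs))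

  Nα : ∀ {n} → (Q.NCt → Set n) → Carrier → NC → Set (c ⊔ ℓ ⊔ n)
  Nα N α x = Σ NCt λ f → Tensor N f × (x ≋NC eval α f)

module Submission where

-- The heart of the proof is coefficient extraction (module Extraction): for g ∈ N and
-- every d, the coefficient of tᵈ in g, viewed as a constant, again lies in N.  The
-- operators Lₘ = 1 − t/(m+1)·d/dt preserve N, fix constants and annihilate tᵐ⁺¹, so
-- L_(B-1) ∘ ⋯ ∘ L₀ sends h ∈ N of degree < B to its constant term; applied to the
-- d-th derivative of g divided by d! it yields the coefficient of tᵈ.  (Here we divide
-- by positive integers, i.e. use that ℚ has characteristic 0.)  Extraction passes to
-- A ⊗ N summand by summand (module BaseChange), and the two halves of the theorem follow:
--   * N_α ⊂ A ⊗ N, because F(α) = Σₖ αᵏ·Fₖ for the coefficients Fₖ ∈ A ⊗ N of F;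
--   * A ⊗ N is spanned by N_α, because f = Σₖ tᵏ·fₖ and each constant fₖ equals fₖ(α).

import Level
open import Algebra.Bundles using (CommutativeRing)
open import Algebra.Morphism.Structures using (module RingMorphisms)
open import Data.Empty using (⊥-elim)
open import Data.List using (List; []; _∷_; map; _++_; applyDownFrom)
open import Data.List.Properties using (≡-dec; map-applyDownFrom)
open import Data.List.Relation.Unary.All using (All; []; _∷_)
open import Data.List.Relation.Unary.All.Properties using (++⁺; map⁺; applyDownFrom⁺₂)
open import Data.Nat as ℕ using (ℕ; zero; suc; _∸_; _⊔_; _≤_; _<_; z≤n; s≤s)
open import Data.Nat.GeneralisedArithmetic using (iterate)
import Data.Nat.Properties as ℕP
open import Data.Product using (_×_; _,_; Σ; proj₁; proj₂)
open import Data.Rational using (ℚ)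
open import Data.Rational.Properties using (+-*-commutativeRing)
open import Data.Sum using (_⊎_; inj₁; inj₂)
open import Relation.Binary.PropositionalEquality as P using (_≡_; _≢_)
open import Relation.Nullary using (yes; no; Dec)
open import Defs

module Coefficients {c ℓ} (R : CommutativeRing c ℓ) where
  open CommutativeRing R
  open Poly R
  open import Relation.Binary.Reasoning.Setoid setoid

  monomial : Carrier → ℕ → Pol
  monomial a j = (a , j) ∷ []

  coeff-term-hit : ∀ a v j w k → v ≡ w → j ≡ k → coeff ((a , v , j) ∷ []) w k ≈ a
  coeff-term-hit a v j w k v≡w j≡k with ≡-dec ℕ._≟_ v w | j ℕ.≟ k
  ... | yes _   | yes _   = +-identityʳ a
  ... | yes _   | no j≢k  = ⊥-elim (j≢k j≡k)
  ... | no v≢w  | _       = ⊥-elim (v≢w v≡w)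

  coeff-term-miss : ∀ a v j w k → v ≢ w ⊎ j ≢ k → coeff ((a , v , j) ∷ []) w k ≈ 0#
  coeff-term-miss a v j w k miss with ≡-dec ℕ._≟_ v w | j ℕ.≟ k | miss
  ... | yes v≡w | yes _   | inj₁ v≢w = ⊥-elim (v≢w v≡w)
  ... | yes _   | yes j≡k | inj₂ j≢k = ⊥-elim (j≢k j≡k)
  ... | yes _   | no _    | _        = refl
  ... | no _    | _       | _        = refl

  coeffNC-term-hit : ∀ a v w → v ≡ w → coeffNC ((a , v) ∷ []) w ≈ a
  coeffNC-term-hit a v w v≡w with ≡-dec ℕ._≟_ v w
  ... | yes _  = +-identityʳ a
  ... | no v≢w = ⊥-elim (v≢w v≡w)

  coeffNC-term-miss : ∀ a v w → v ≢ w → coeffNC ((a , v) ∷ []) w ≈ 0#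
  coeffNC-term-miss a v w v≢w with ≡-dec ℕ._≟_ v w
  ... | yes v≡w = ⊥-elim (v≢w v≡w)
  ... | no _    = refl

  coeff-∷ : ∀ t f w k → coeff (t ∷ f) w k ≈ coeff (t ∷ []) w k + coeff f w k
  coeff-∷ (a , v , j) f w k with ≡-dec ℕ._≟_ v w | j ℕ.≟ k
  ... | yes _ | yes _ = +-congʳ (sym (+-identityʳ a))
  ... | yes _ | no _  = sym (+-identityˡ _)
  ... | no _  | _     = sym (+-identityˡ _)

  coeffNC-∷ : ∀ t f w → coeffNC (t ∷ f) w ≈ coeffNC (t ∷ []) w + coeffNC f w
  coeffNC-∷ (a , v) f w with ≡-dec ℕ._≟_ v w
  ... | yes _ = +-congʳ (sym (+-identityʳ a))
  ... | no _  = sym (+-identityˡ _)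

  coeff-⊕ : ∀ f g w k → coeff (f ⊕ g) w k ≈ coeff f w k + coeff g w k
  coeff-⊕ []      g w k = sym (+-identityˡ _)
  coeff-⊕ (t ∷ f) g w k = begin
    coeff (t ∷ (f ++ g)) w k                          ≈⟨ coeff-∷ t (f ++ g) w k ⟩
    coeff (t ∷ []) w k + coeff (f ++ g) w k           ≈⟨ +-congˡ (coeff-⊕ f g w k) ⟩
    coeff (t ∷ []) w k + (coeff f w k + coeff g w k)  ≈⟨ sym (+-assoc _ _ _) ⟩
    (coeff (t ∷ []) w k + coeff f w k) + coeff g w k  ≈⟨ +-congʳ (sym (coeff-∷ t f w k)) ⟩
    coeff (t ∷ f) w k + coeff g w k                   ∎

  coeff-monomial-shift : ∀ b j f w k → coeff (monomial b j · f) w (j ℕ.+ k) ≈ b * coeff f w k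
  coeff-monomial-shift b j []              w k = sym (zeroʳ b)
  coeff-monomial-shift b j ((a , v , i) ∷ f) w k = begin
    coeff ((b * a , v , j ℕ.+ i) ∷ (monomial b j · f)) w (j ℕ.+ k)
      ≈⟨ coeff-∷ (b * a , v , j ℕ.+ i) (monomial b j · f) w (j ℕ.+ k) ⟩
    coeff ((b * a , v , j ℕ.+ i) ∷ []) w (j ℕ.+ k) + coeff (monomial b j · f) w (j ℕ.+ k)
      ≈⟨ +-cong (shiftTerm (≡-dec ℕ._≟_ v w) (i ℕ.≟ k)) (coeff-monomial-shift b j f w k) ⟩
    b * coeff ((a , v , i) ∷ []) w k + b * coeff f w k
      ≈⟨ sym (distribˡ b _ _) ⟩
    b * (coeff ((a , v , i) ∷ []) w k + coeff f w k)
      ≈⟨ *-congˡ (sym (coeff-∷ (a , v , i) f w k)) ⟩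
    b * coeff ((a , v , i) ∷ f) w k ∎
    where
    shiftTerm : Dec (v ≡ w) → Dec (i ≡ k) →
                coeff ((b * a , v , j ℕ.+ i) ∷ []) w (j ℕ.+ k) ≈ b * coeff ((a , v , i) ∷ []) w k
    shiftTerm (yes v≡w) (yes i≡k) =
      trans (coeff-term-hit _ v _ w _ v≡w (P.cong (j ℕ.+_) i≡k)) (*-congˡ (sym (coeff-term-hit a v i w k v≡w i≡k)))
    shiftTerm (yes _)   (no i≢k)  =
      trans (coeff-term-miss _ v _ w _ (inj₂ (λ e → i≢k (ℕP.+-cancelˡ-≡ j i k e))))
            (trans (sym (zeroʳ b)) (*-congˡ (sym (coeff-term-miss a v i w k (inj₂ i≢k)))))
    shiftTerm (no v≢w)  _         =
      trans (coeff-term-miss _ v _ w _ (inj₁ v≢w))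
            (trans (sym (zeroʳ b)) (*-congˡ (sym (coeff-term-miss a v i w k (inj₁ v≢w)))))

  coeff-monomial-below : ∀ b j f w k → k < j → coeff (monomial b j · f) w k ≈ 0#
  coeff-monomial-below b j []              w k k<j = refl
  coeff-monomial-below b j ((a , v , i) ∷ f) w k k<j = begin
    coeff ((b * a , v , j ℕ.+ i) ∷ (monomial b j · f)) w k
      ≈⟨ coeff-∷ (b * a , v , j ℕ.+ i) (monomial b j · f) w k ⟩
    coeff ((b * a , v , j ℕ.+ i) ∷ []) w k + coeff (monomial b j · f) w k
      ≈⟨ +-cong (coeff-term-miss _ v _ w k (inj₂ j+i≢k)) (coeff-monomial-below b j f w k k<j) ⟩
    0# + 0#
      ≈⟨ +-identityʳ 0# ⟩
    0# ∎
    where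
    j+i≢k : j ℕ.+ i ≢ k
    j+i≢k e = ℕP.<⇒≢ (ℕP.<-≤-trans k<j (ℕP.m≤m+n j i)) (P.sym e)

  coeff-scale : ∀ a f w k → coeff (monomial a 0 · f) w k ≈ a * coeff f w k
  coeff-scale a = coeff-monomial-shift a 0

  IsConstant : NCt → Set ℓ
  IsConstant f = ∀ w k → coeff f w (suc k) ≈ 0#

  coeff-const-zero : ∀ x w → coeff (const x) w 0 ≈ coeffNC x w
  coeff-const-zero []            w = refl
  coeff-const-zero ((a , v) ∷ x) w = begin
    coeff ((a , v , 0) ∷ const x) w 0                ≈⟨ coeff-∷ (a , v , 0) (const x) w 0 ⟩
    coeff ((a , v , 0) ∷ []) w 0 + coeff (const x) w 0 ≈⟨ +-cong (constTerm (≡-dec ℕ._≟_ v w)) (coeff-const-zero x w) ⟩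
    coeffNC ((a , v) ∷ []) w + coeffNC x w           ≈⟨ sym (coeffNC-∷ (a , v) x w) ⟩
    coeffNC ((a , v) ∷ x) w                          ∎
    where
    constTerm : Dec (v ≡ w) → coeff ((a , v , 0) ∷ []) w 0 ≈ coeffNC ((a , v) ∷ []) w
    constTerm (yes v≡w) = trans (coeff-term-hit a v 0 w 0 v≡w P.refl) (sym (coeffNC-term-hit a v w v≡w))
    constTerm (no v≢w)  = trans (coeff-term-miss a v 0 w 0 (inj₁ v≢w)) (sym (coeffNC-term-miss a v w v≢w))

  const-isConstant : ∀ x → IsConstant (const x)
  const-isConstant []            w k = refl
  const-isConstant ((a , v) ∷ x) w k = begin
    coeff ((a , v , 0) ∷ const x) w (suc k)                      ≈⟨ coeff-∷ (a , v , 0) (const x) w (suc k) ⟩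
    coeff ((a , v , 0) ∷ []) w (suc k) + coeff (const x) w (suc k) ≈⟨ +-cong (coeff-term-miss a v 0 w (suc k) (inj₂ λ ())) (const-isConstant x w k) ⟩
    0# + 0#                                                      ≈⟨ +-identityʳ 0# ⟩
    0#                                                           ∎

  coeff-monomial-const-hit : ∀ a d x w → coeff (monomial a d · const x) w d ≈ a * coeffNC x w
  coeff-monomial-const-hit a d x w =
    P.subst (λ e → coeff (monomial a d · const x) w e ≈ a * coeffNC x w) (ℕP.+-identityʳ d)
      (trans (coeff-monomial-shift a d (const x) w 0) (*-congˡ (coeff-const-zero x w)))

  coeff-monomial-const-miss : ∀ a d x w k → d ≢ k → coeff (monomial a d · const x) w k ≈ 0#
  coeff-monomial-const-miss a d x w k d≢k with k ℕ.<? d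
  ... | yes k<d = coeff-monomial-below a d (const x) w k k<d
  ... | no k≮d  = above (k ∸ d) (ℕP.m+[n∸m]≡n (ℕP.≮⇒≥ k≮d))
    where
    above : ∀ m → d ℕ.+ m ≡ k → coeff (monomial a d · const x) w k ≈ 0#
    above zero    e      = ⊥-elim (d≢k (P.trans (P.sym (ℕP.+-identityʳ d)) e))
    above (suc m) P.refl =
      trans (coeff-monomial-shift a d (const x) w (suc m)) (trans (*-congˡ (const-isConstant x w m)) (zeroʳ a))

  -- A strict upper bound for the t-degrees occurring in f.
  degreeBound : NCt → ℕ
  degreeBound []              = 0
  degreeBound ((_ , _ , j) ∷ f) = suc j ⊔ degreeBound f

  coeff-degreeBound : ∀ f w k → degreeBound f ≤ k → coeff f w k ≈ 0#
  coeff-degreeBound []              w k _ = refl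
  coeff-degreeBound ((a , v , j) ∷ f) w k bound≤k = begin
    coeff ((a , v , j) ∷ f) w k                  ≈⟨ coeff-∷ (a , v , j) f w k ⟩
    coeff ((a , v , j) ∷ []) w k + coeff f w k   ≈⟨ +-cong (coeff-term-miss a v j w k (inj₂ j≢k)) rest ⟩
    0# + 0#                                      ≈⟨ +-identityʳ 0# ⟩
    0#                                           ∎
    where
    j≢k : j ≢ k
    j≢k = ℕP.<⇒≢ (ℕP.m⊔n≤o⇒m≤o (suc j) (degreeBound f) bound≤k)
    rest : coeff f w k ≈ 0#
    rest = coeff-degreeBound f w k (ℕP.m⊔n≤o⇒n≤o (suc j) (degreeBound f) bound≤k)

  nat : ℕ → Carrier
  nat n = natMul n 1#

  natMul≈nat* : ∀ n a → natMul n a ≈ nat n * a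
  natMul≈nat* zero    a = sym (zeroˡ a)
  natMul≈nat* (suc n) a = trans (+-cong (sym (*-identityˡ a)) (natMul≈nat* n a)) (sym (distribʳ a 1# _))

  coeff-zeroTerm : ∀ v j w k → coeff ((0# , v , j) ∷ []) w k ≈ 0#
  coeff-zeroTerm v j w k with ≡-dec ℕ._≟_ v w | j ℕ.≟ k
  ... | yes _ | yes _ = +-identityʳ 0#
  ... | yes _ | no _  = refl
  ... | no _  | _     = refl

  coeff-deriv : ∀ f w k → coeff (deriv f) w k ≈ nat (suc k) * coeff f w (suc k)
  coeff-deriv []              w k = sym (zeroʳ _)
  coeff-deriv ((a , v , j) ∷ f) w k = begin
    coeff ((natMul j a , v , j ∸ 1) ∷ deriv f) w k
      ≈⟨ coeff-∷ (natMul j a , v , j ∸ 1) (deriv f) w k ⟩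
    coeff ((natMul j a , v , j ∸ 1) ∷ []) w k + coeff (deriv f) w k
      ≈⟨ +-cong (derivTerm (≡-dec ℕ._≟_ v w) j) (coeff-deriv f w k) ⟩
    nat (suc k) * coeff ((a , v , j) ∷ []) w (suc k) + nat (suc k) * coeff f w (suc k)
      ≈⟨ sym (distribˡ _ _ _) ⟩
    nat (suc k) * (coeff ((a , v , j) ∷ []) w (suc k) + coeff f w (suc k))
      ≈⟨ *-congˡ (sym (coeff-∷ (a , v , j) f w (suc k))) ⟩
    nat (suc k) * coeff ((a , v , j) ∷ f) w (suc k) ∎
    where
    rhs-miss : ∀ {i} → v ≢ w ⊎ i ≢ suc k → 0# ≈ nat (suc k) * coeff ((a , v , i) ∷ []) w (suc k)
    rhs-miss miss = sym (trans (*-congˡ (coeff-term-miss a v _ w (suc k) miss)) (zeroʳ _))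
    derivTerm : Dec (v ≡ w) → ∀ j →
                coeff ((natMul j a , v , j ∸ 1) ∷ []) w k ≈ nat (suc k) * coeff ((a , v , j) ∷ []) w (suc k)
    derivTerm (no v≢w)  j       = trans (coeff-term-miss _ v _ w k (inj₁ v≢w)) (rhs-miss (inj₁ v≢w))
    derivTerm (yes _)   zero    = trans (coeff-zeroTerm v 0 w k) (rhs-miss (inj₂ λ ()))
    derivTerm (yes v≡w) (suc i) = succTerm (i ℕ.≟ k)
      where
      succTerm : Dec (i ≡ k) →
                 coeff ((natMul (suc i) a , v , i) ∷ []) w k ≈ nat (suc k) * coeff ((a , v , suc i) ∷ []) w (suc k)
      succTerm (yes P.refl) = trans (coeff-term-hit _ v i w i v≡w P.refl)
        (trans (natMul≈nat* (suc i) a) (*-congˡ (sym (coeff-term-hit a v (suc i) w (suc i) v≡w P.refl))))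
      succTerm (no i≢k)     = trans (coeff-term-miss _ v i w k (inj₂ i≢k)) (rhs-miss (inj₂ (λ e → i≢k (ℕP.suc-injective e))))

  -- derivFactor k d = (k+1)(k+2)⋯(k+d), the factor by which the d-th derivative maps tᵏ⁺ᵈ to tᵏ.
  derivFactor : ℕ → ℕ → Carrier
  derivFactor k zero    = 1#
  derivFactor k (suc d) = derivFactor k d * nat (suc (d ℕ.+ k))

  coeff-iterate-deriv : ∀ d f w k → coeff (iterate deriv f d) w k ≈ derivFactor k d * coeff f w (d ℕ.+ k)
  coeff-iterate-deriv zero    f w k = sym (*-identityˡ _)
  coeff-iterate-deriv (suc d) f w k = begin
    coeff (iterate deriv (deriv f) d) w k
      ≈⟨ coeff-iterate-deriv d (deriv f) w k ⟩
    derivFactor k d * coeff (deriv f) w (d ℕ.+ k)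
      ≈⟨ *-congˡ (coeff-deriv f w (d ℕ.+ k)) ⟩
    derivFactor k d * (nat (suc (d ℕ.+ k)) * coeff f w (suc d ℕ.+ k))
      ≈⟨ sym (*-assoc _ _ _) ⟩
    derivFactor k (suc d) * coeff f w (suc d ℕ.+ k) ∎

  -- finite sums  sumTo B h = h (B-1) + ⋯ + h 0 , in the order of applyDownFrom
  sumTo : ℕ → (ℕ → Carrier) → Carrier
  sumTo zero    h = 0#
  sumTo (suc B) h = h B + sumTo B h

  sumTo-cong : ∀ B {h h′} → (∀ k → h k ≈ h′ k) → sumTo B h ≈ sumTo B h′
  sumTo-cong zero    h≈h′ = refl
  sumTo-cong (suc B) h≈h′ = +-cong (h≈h′ B) (sumTo-cong B h≈h′)

  sumTo-+ : ∀ B h h′ → sumTo B (λ k → h k + h′ k) ≈ sumTo B h + sumTo B h′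
  sumTo-+ zero    h h′ = sym (+-identityʳ 0#)
  sumTo-+ (suc B) h h′ = begin
    (h B + h′ B) + sumTo B (λ k → h k + h′ k) ≈⟨ +-congˡ (sumTo-+ B h h′) ⟩
    (h B + h′ B) + (sumTo B h + sumTo B h′)   ≈⟨ +-assoc _ _ _ ⟩
    h B + (h′ B + (sumTo B h + sumTo B h′))   ≈⟨ +-congˡ (sym (+-assoc _ _ _)) ⟩
    h B + ((h′ B + sumTo B h) + sumTo B h′)   ≈⟨ +-congˡ (+-congʳ (+-comm _ _)) ⟩
    h B + ((sumTo B h + h′ B) + sumTo B h′)   ≈⟨ +-congˡ (+-assoc _ _ _) ⟩
    h B + (sumTo B h + (h′ B + sumTo B h′))   ≈⟨ sym (+-assoc _ _ _) ⟩
    (h B + sumTo B h) + (h′ B + sumTo B h′)   ∎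

  sumTo-outside : ∀ B k {h} → (∀ d → d ≢ k → h d ≈ 0#) → B ≤ k → sumTo B h ≈ 0#
  sumTo-outside zero    k h₀ B≤k = refl
  sumTo-outside (suc B) k h₀ B<k =
    trans (+-cong (h₀ B (ℕP.<⇒≢ B<k)) (sumTo-outside B k h₀ (ℕP.<⇒≤ B<k))) (+-identityʳ 0#)

  sumTo-single : ∀ B k {h} → (∀ d → d ≢ k → h d ≈ 0#) → k < B → sumTo B h ≈ h k
  sumTo-single (suc B) k {h} h₀ (s≤s k≤B) with k ℕ.≟ B
  ... | yes P.refl = trans (+-congˡ (sumTo-outside B k h₀ ℕP.≤-refl)) (+-identityʳ _)
  ... | no k≢B     = trans (+-cong (h₀ B (λ e → k≢B (P.sym e))) (sumTo-single B k h₀ (ℕP.≤∧≢⇒< k≤B k≢B))) (+-identityˡ _)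

  sumTo-zero : ∀ B {h} → (∀ k → h k ≈ 0#) → sumTo B h ≈ 0#
  sumTo-zero B h₀ = sumTo-outside B B (λ d _ → h₀ d) ℕP.≤-refl

  coeff-sumDown : ∀ (h : ℕ → NCt) B w k → coeff (sumNCt (applyDownFrom h B)) w k ≈ sumTo B (λ d → coeff (h d) w k)
  coeff-sumDown h zero    w k = refl
  coeff-sumDown h (suc B) w k = trans (coeff-⊕ (h B) _ w k) (+-congˡ (coeff-sumDown h B w k))

  coeff-eval : ∀ α F B w → degreeBound F ≤ B → coeffNC (eval α F) w ≈ sumTo B (λ k → pow α k * coeff F w k)
  coeff-eval α []              B w _ = sym (sumTo-zero B (λ k → zeroʳ _))
  coeff-eval α ((a , v , j) ∷ F) B w bound≤B = begin
    coeffNC ((a * pow α j , v) ∷ eval α F) w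
      ≈⟨ coeffNC-∷ (a * pow α j , v) (eval α F) w ⟩
    coeffNC ((a * pow α j , v) ∷ []) w + coeffNC (eval α F) w
      ≈⟨ +-cong (trans (evalTerm (≡-dec ℕ._≟_ v w)) (sym (sumTo-single B j offTerm j<B)))
                (coeff-eval α F B w (ℕP.m⊔n≤o⇒n≤o (suc j) (degreeBound F) bound≤B)) ⟩
    sumTo B (λ k → pow α k * coeff ((a , v , j) ∷ []) w k) + sumTo B (λ k → pow α k * coeff F w k)
      ≈⟨ sym (sumTo-+ B _ _) ⟩
    sumTo B (λ k → pow α k * coeff ((a , v , j) ∷ []) w k + pow α k * coeff F w k)
      ≈⟨ sumTo-cong B (λ k → trans (sym (distribˡ _ _ _)) (*-congˡ (sym (coeff-∷ (a , v , j) F w k)))) ⟩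
    sumTo B (λ k → pow α k * coeff ((a , v , j) ∷ F) w k) ∎
    where
    j<B : j < B
    j<B = ℕP.m⊔n≤o⇒m≤o (suc j) (degreeBound F) bound≤B
    offTerm : ∀ d → d ≢ j → pow α d * coeff ((a , v , j) ∷ []) w d ≈ 0#
    offTerm d d≢j = trans (*-congˡ (coeff-term-miss a v j w d (inj₂ (λ e → d≢j (P.sym e))))) (zeroʳ _)
    evalTerm : Dec (v ≡ w) → coeffNC ((a * pow α j , v) ∷ []) w ≈ pow α j * coeff ((a , v , j) ∷ []) w j
    evalTerm (yes v≡w) = trans (coeffNC-term-hit _ v w v≡w) (trans (*-comm _ _) (*-congˡ (sym (coeff-term-hit a v j w j v≡w P.refl))))
    evalTerm (no v≢w)  = trans (coeffNC-term-miss _ v w v≢w) (sym (trans (*-congˡ (coeff-term-miss a v j w j (inj₁ v≢w))) (zeroʳ _)))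

  eval-constant : ∀ α c w → IsConstant c → coeffNC (eval α c) w ≈ coeff c w 0
  eval-constant α c w c-const = begin
    coeffNC (eval α c) w                             ≈⟨ coeff-eval α c B w (ℕP.n≤1+n _) ⟩
    sumTo B (λ k → pow α k * coeff c w k)            ≈⟨ sumTo-single B 0 higher (s≤s z≤n) ⟩
    1# * coeff c w 0                                 ≈⟨ *-identityˡ _ ⟩
    coeff c w 0                                      ∎
    where
    B = suc (degreeBound c)
    higher : ∀ d → d ≢ 0 → pow α d * coeff c w d ≈ 0#
    higher zero    d≢0 = ⊥-elim (d≢0 P.refl)
    higher (suc d) _   = trans (*-congˡ (c-const w d)) (zeroʳ _)

module Units {c ℓ} (R : CommutativeRing c ℓ) where
  open CommutativeRing R
  open import Relation.Binary.Reasoning.Setoid setoid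

  -- p has a (left, hence two-sided) inverse
  Invertible : Carrier → Set (c Level.⊔ ℓ)
  Invertible p = Σ Carrier λ q → q * p ≈ 1#

  invertible-* : ∀ {p p′} → Invertible p → Invertible p′ → Invertible (p * p′)
  invertible-* {p} {p′} (q , qp≈1) (q′ , q′p′≈1) = q * q′ , (begin
    (q * q′) * (p * p′) ≈⟨ *-assoc q q′ _ ⟩
    q * (q′ * (p * p′)) ≈⟨ *-congˡ (trans (sym (*-assoc q′ p p′)) (*-congʳ (*-comm q′ p))) ⟩
    q * ((p * q′) * p′) ≈⟨ *-congˡ (*-assoc p q′ p′) ⟩
    q * (p * (q′ * p′)) ≈⟨ sym (*-assoc q p _) ⟩
    (q * p) * (q′ * p′) ≈⟨ *-cong qp≈1 q′p′≈1 ⟩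
    1# * 1#             ≈⟨ *-identityˡ 1# ⟩
    1#                  ∎)

module Extraction where
  import Data.Rational as ℚ
  import Data.Rational.Properties as ℚP
  open CommutativeRing +-*-commutativeRing
  open Poly +-*-commutativeRing
  open Coefficients +-*-commutativeRing
  open Units +-*-commutativeRing
  open import Algebra.Properties.Ring ring using (-‿distribˡ-*)
  open P.≡-Reasoning

  nat-nonNegative : ∀ n → ℚ.NonNegative (nat n)
  nat-nonNegative zero    = _
  nat-nonNegative (suc n) = ℚP.nonNeg+nonNeg⇒nonNeg 1# (nat n) {{nat-nonNegative n}}

  nat-suc-invertible : ∀ n → Invertible (nat (suc n))
  nat-suc-invertible n = (ℚ.1/ nat (suc n)) {{nonZero}} , ℚP.*-inverseˡ (nat (suc n)) {{nonZero}}
    where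
    nonZero : ℚ.NonZero (nat (suc n))
    nonZero = ℚP.pos⇒nonZero (nat (suc n)) {{ℚP.pos+nonNeg⇒pos 1# (nat n) {{nat-nonNegative n}}}}

  derivFactor-invertible : ∀ k d → Invertible (derivFactor k d)
  derivFactor-invertible k zero    = 1# , *-identityˡ 1#
  derivFactor-invertible k (suc d) = invertible-* (derivFactor-invertible k d) (nat-suc-invertible (d ℕ.+ k))

  inv : ℕ → ℚ
  inv m = proj₁ (nat-suc-invertible m)

  -- The operator Lₘ = 1 − t/(m+1)·d/dt multiplies tᵏ by killerFactor m k = 1 − k/(m+1):
  -- it fixes constants and annihilates tᵐ⁺¹.
  killer : ℕ → NCt → NCt
  killer m h = h ⊕ (monomial (- inv m) 1 · deriv h)

  killerFactor : ℕ → ℕ → ℚ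
  killerFactor m zero    = 1#
  killerFactor m (suc k) = 1# + (- inv m) * nat (suc k)

  coeff-killer : ∀ m h w k → coeff (killer m h) w k ≡ killerFactor m k * coeff h w k
  coeff-killer m h w zero = begin
    coeff (killer m h) w 0                                   ≡⟨ coeff-⊕ h _ w 0 ⟩
    coeff h w 0 + coeff (monomial (- inv m) 1 · deriv h) w 0 ≡⟨ P.cong (coeff h w 0 +_) (coeff-monomial-below (- inv m) 1 (deriv h) w 0 (s≤s z≤n)) ⟩
    coeff h w 0 + 0#                                         ≡⟨ +-identityʳ _ ⟩
    coeff h w 0                                              ≡⟨ P.sym (*-identityˡ _) ⟩
    1# * coeff h w 0                                         ∎
  coeff-killer m h w (suc k) = begin
    coeff (killer m h) w (suc k)                         ≡⟨ coeff-⊕ h _ w (suc k) ⟩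
    c + coeff (monomial (- inv m) 1 · deriv h) w (suc k) ≡⟨ P.cong (c +_) (coeff-monomial-shift (- inv m) 1 (deriv h) w k) ⟩
    c + (- inv m) * coeff (deriv h) w k                  ≡⟨ P.cong (λ x → c + (- inv m) * x) (coeff-deriv h w k) ⟩
    c + (- inv m) * (nat (suc k) * c)                    ≡⟨ P.cong (c +_) (P.sym (*-assoc (- inv m) (nat (suc k)) c)) ⟩
    c + ((- inv m) * nat (suc k)) * c                    ≡⟨ P.cong (_+ ((- inv m) * nat (suc k)) * c) (P.sym (*-identityˡ c)) ⟩
    1# * c + ((- inv m) * nat (suc k)) * c               ≡⟨ P.sym (distribʳ c 1# ((- inv m) * nat (suc k))) ⟩
    killerFactor m (suc k) * c                           ∎
    where
    c = coeff h w (suc k)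

  killerFactor-root : ∀ m → killerFactor m (suc m) ≡ 0#
  killerFactor-root m = begin
    1# + (- inv m) * nat (suc m) ≡⟨ P.cong (1# +_) (P.sym (-‿distribˡ-* (inv m) _)) ⟩
    1# + - (inv m * nat (suc m)) ≡⟨ P.cong (λ x → 1# + - x) (proj₂ (nat-suc-invertible m)) ⟩
    1# + - 1#                    ≡⟨ -‿inverseʳ 1# ⟩
    0#                           ∎

  -- killBelow B = L_(B-1) ∘ ⋯ ∘ L₀ fixes constants and annihilates t¹, …, tᴮ.
  killBelow : ℕ → NCt → NCt
  killBelow zero    h = h
  killBelow (suc m) h = killer m (killBelow m h)

  killProduct : ℕ → ℕ → ℚ
  killProduct zero    k = 1#
  killProduct (suc m) k = killerFactor m k * killProduct m k

  coeff-killBelow : ∀ B h w k → coeff (killBelow B h) w k ≡ killProduct B k * coeff h w k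
  coeff-killBelow zero    h w k = P.sym (*-identityˡ _)
  coeff-killBelow (suc m) h w k = begin
    coeff (killer m (killBelow m h)) w k              ≡⟨ coeff-killer m (killBelow m h) w k ⟩
    killerFactor m k * coeff (killBelow m h) w k      ≡⟨ P.cong (killerFactor m k *_) (coeff-killBelow m h w k) ⟩
    killerFactor m k * (killProduct m k * coeff h w k) ≡⟨ P.sym (*-assoc (killerFactor m k) (killProduct m k) (coeff h w k)) ⟩
    killProduct (suc m) k * coeff h w k               ∎

  killProduct-constant : ∀ B → killProduct B 0 ≡ 1#
  killProduct-constant zero    = P.refl
  killProduct-constant (suc m) = P.trans (P.cong (1# *_) (killProduct-constant m)) (*-identityˡ 1#)

  -- for 1 ≤ k ≤ B one of the factors is killerFactor (k-1) k = 0
  killProduct-vanishes : ∀ B k → k < B → killProduct B (suc k) ≡ 0#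
  killProduct-vanishes (suc m) k (s≤s k≤m) with k ℕ.≟ m
  ... | yes P.refl = P.trans (P.cong (_* killProduct k (suc k)) (killerFactor-root k)) (zeroˡ (killProduct k (suc k)))
  ... | no k≢m     = P.trans (P.cong (killerFactor m (suc k) *_) (killProduct-vanishes m k (ℕP.≤∧≢⇒< k≤m k≢m))) (zeroʳ (killerFactor m (suc k)))

  module _ {n} (N : NCt → Set n) (DN : IsDiffSubmodule N) where
    open IsDiffSubmodule DN

    iterate-deriv-mem : ∀ d {f} → N f → N (iterate deriv f d)
    iterate-deriv-mem zero    f∈N = f∈N
    iterate-deriv-mem (suc d) f∈N = iterate-deriv-mem d (derivMem f∈N)

    killBelow-mem : ∀ B {h} → N h → N (killBelow B h)
    killBelow-mem zero    h∈N = h∈N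
    killBelow-mem (suc m) h∈N =
      addMem (killBelow-mem m h∈N) (smulMem (monomial (- inv m) 1) (derivMem (killBelow-mem m h∈N)))

    record ConstantIn (coeffs : Word → ℚ) : Set n where
      constructor constantIn
      field
        element      : NCt
        member       : N element
        constantPart : ∀ w → coeff element w 0 ≡ coeffs w
        isConstant   : IsConstant element

    -- N contains the constant term h(0) of each of its elements h:
    -- apply L₀, …, L_(B-1) with tᴮ beyond the degree of h.
    constantTerm-mem : ∀ {h} → N h → ConstantIn (λ w → coeff h w 0)
    constantTerm-mem {h} h∈N = constantIn (killBelow B h) (killBelow-mem B h∈N) constantPart higherParts
      where
      B = degreeBound h
      constantPart : ∀ w → coeff (killBelow B h) w 0 ≡ coeff h w 0
      constantPart w = begin
        coeff (killBelow B h) w 0 ≡⟨ coeff-killBelow B h w 0 ⟩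
        killProduct B 0 * coeff h w 0 ≡⟨ P.cong (_* coeff h w 0) (killProduct-constant B) ⟩
        1# * coeff h w 0 ≡⟨ *-identityˡ _ ⟩
        coeff h w 0 ∎
      higherPart : ∀ w k → Dec (k < B) → killProduct B (suc k) * coeff h w (suc k) ≡ 0#
      higherPart w k (yes k<B) = P.trans (P.cong (_* coeff h w (suc k)) (killProduct-vanishes B k k<B)) (zeroˡ (coeff h w (suc k)))
      higherPart w k (no k≮B)  =
        P.trans (P.cong (killProduct B (suc k) *_) (coeff-degreeBound h w (suc k) (ℕP.m≤n⇒m≤1+n (ℕP.≮⇒≥ k≮B)))) (zeroʳ (killProduct B (suc k)))
      higherParts : IsConstant (killBelow B h)
      higherParts w k = P.trans (coeff-killBelow B h w (suc k)) (higherPart w k (k ℕ.<? B))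

    -- N contains, for each d, the coefficient of tᵈ in each g ∈ N, as a constant:
    -- it is the constant term of the d-th derivative divided by d!.
    coefficient-mem : ∀ {g} → N g → ∀ d → ConstantIn (λ w → coeff g w d)
    coefficient-mem {g} g∈N d =
      let constantIn c c∈N c₀ c-const = constantTerm-mem (smulMem (monomial q 0) (iterate-deriv-mem d g∈N))
      in  constantIn c c∈N (λ w → P.trans (c₀ w) (divideByFactorial w)) c-const
      where
      q : ℚ
      q = proj₁ (derivFactor-invertible 0 d)
      divideByFactorial : ∀ w → coeff (monomial q 0 · iterate deriv g d) w 0 ≡ coeff g w d
      divideByFactorial w = begin
        coeff (monomial q 0 · iterate deriv g d) w 0 ≡⟨ coeff-scale q (iterate deriv g d) w 0 ⟩
        q * coeff (iterate deriv g d) w 0            ≡⟨ P.cong (q *_) (coeff-iterate-deriv d g w 0) ⟩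
        q * (derivFactor 0 d * coeff g w (d ℕ.+ 0))  ≡⟨ P.sym (*-assoc q _ _) ⟩
        (q * derivFactor 0 d) * coeff g w (d ℕ.+ 0)  ≡⟨ P.cong₂ _*_ (proj₂ (derivFactor-invertible 0 d)) (P.cong (coeff g w) (ℕP.+-identityʳ d)) ⟩
        1# * coeff g w d                             ≡⟨ *-identityˡ _ ⟩
        coeff g w d                                  ∎

module BaseChange {n} (N : Q.NCt → Set n) (DN : IsDiffSubmodule N)
                  {c ℓ} (A : CommutativeRing c ℓ) (φ : ℚ → CommutativeRing.Carrier A) (φ-hom : IsQAlgebraStr A φ) where
  open CommutativeRing A
  open Poly A
  open Coefficients A
  open Base A φ
  module CQ = Coefficients +-*-commutativeRing
  open RingMorphisms (CommutativeRing.rawRing +-*-commutativeRing) (CommutativeRing.rawRing A)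
  open IsRingHomomorphism φ-hom using (+-homo; 0#-homo)
  open import Relation.Binary.Reasoning.Setoid setoid

  φ-cong : ∀ {p q} → p ≡ q → φ p ≈ φ q
  φ-cong p≡q = reflexive (P.cong φ p≡q)

  φ-zero : ∀ {p} → p ≡ CommutativeRing.0# +-*-commutativeRing → φ p ≈ 0#
  φ-zero p≡0 = trans (φ-cong p≡0) 0#-homo

  coeff-ι : ∀ g w k → coeff (ι g) w k ≈ φ (Q.coeff g w k)
  coeff-ι []              w k = sym 0#-homo
  coeff-ι ((q , v , j) ∷ g) w k = begin
    coeff ((φ q , v , j) ∷ ι g) w k                           ≈⟨ coeff-∷ (φ q , v , j) (ι g) w k ⟩
    coeff ((φ q , v , j) ∷ []) w k + coeff (ι g) w k          ≈⟨ +-cong (liftTerm (≡-dec ℕ._≟_ v w) (j ℕ.≟ k)) (coeff-ι g w k) ⟩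
    φ (Q.coeff ((q , v , j) ∷ []) w k) + φ (Q.coeff g w k)    ≈⟨ sym (+-homo _ _) ⟩
    φ (Q.coeff ((q , v , j) ∷ []) w k ℚ+ Q.coeff g w k)       ≈⟨ φ-cong (P.sym (CQ.coeff-∷ (q , v , j) g w k)) ⟩
    φ (Q.coeff ((q , v , j) ∷ g) w k)                         ∎
    where
    open CommutativeRing +-*-commutativeRing using () renaming (_+_ to _ℚ+_)
    liftTerm : Dec (v ≡ w) → Dec (j ≡ k) → coeff ((φ q , v , j) ∷ []) w k ≈ φ (Q.coeff ((q , v , j) ∷ []) w k)
    liftTerm (yes v≡w) (yes j≡k) = trans (coeff-term-hit _ v j w k v≡w j≡k) (φ-cong (P.sym (CQ.coeff-term-hit q v j w k v≡w j≡k)))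
    liftTerm (yes _)   (no j≢k)  = trans (coeff-term-miss _ v j w k (inj₂ j≢k)) (sym (φ-zero (CQ.coeff-term-miss q v j w k (inj₂ j≢k))))
    liftTerm (no v≢w)  _         = trans (coeff-term-miss _ v j w k (inj₁ v≢w)) (sym (φ-zero (CQ.coeff-term-miss q v j w k (inj₁ v≢w))))

  -- a ⊗ g ∈ A ⊗ h¹[t], and A-linear combinations Σᵢ aᵢ ⊗ gᵢ; Tensor N f says f is such a
  -- combination with all gᵢ ∈ N.
  scaledLift : Carrier × Q.NCt → NCt
  scaledLift ag = monomial (proj₁ ag) 0 · ι (proj₂ ag)

  combination : List (Carrier × Q.NCt) → NCt
  combination gs = sumNCt (map scaledLift gs)

  coeff-scaledLift : ∀ a g w k → coeff (scaledLift (a , g)) w k ≈ a * φ (Q.coeff g w k)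
  coeff-scaledLift a g w k = trans (coeff-scale a (ι g) w k) (*-congˡ (coeff-ι g w k))

  coeff-combination-++ : ∀ gs hs w k →
    coeff (combination (gs ++ hs)) w k ≈ coeff (combination gs) w k + coeff (combination hs) w k
  coeff-combination-++ []        hs w k = sym (+-identityˡ _)
  coeff-combination-++ (ag ∷ gs) hs w k = begin
    coeff (scaledLift ag ⊕ combination (gs ++ hs)) w k
      ≈⟨ coeff-⊕ (scaledLift ag) _ w k ⟩
    coeff (scaledLift ag) w k + coeff (combination (gs ++ hs)) w k
      ≈⟨ +-congˡ (coeff-combination-++ gs hs w k) ⟩
    coeff (scaledLift ag) w k + (coeff (combination gs) w k + coeff (combination hs) w k)
      ≈⟨ sym (+-assoc _ _ _) ⟩
    (coeff (scaledLift ag) w k + coeff (combination gs) w k) + coeff (combination hs) w k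
      ≈⟨ +-congʳ (sym (coeff-⊕ (scaledLift ag) _ w k)) ⟩
    coeff (combination (ag ∷ gs)) w k + coeff (combination hs) w k ∎

  rescale : Carrier → List (Carrier × Q.NCt) → List (Carrier × Q.NCt)
  rescale a gs = map (λ bg → a * proj₁ bg , proj₂ bg) gs

  coeff-combination-rescale : ∀ a gs w k → coeff (combination (rescale a gs)) w k ≈ a * coeff (combination gs) w k
  coeff-combination-rescale a []             w k = sym (zeroʳ a)
  coeff-combination-rescale a ((b , g) ∷ gs) w k = begin
    coeff (scaledLift (a * b , g) ⊕ combination (rescale a gs)) w k
      ≈⟨ coeff-⊕ (scaledLift (a * b , g)) _ w k ⟩
    coeff (scaledLift (a * b , g)) w k + coeff (combination (rescale a gs)) w k
      ≈⟨ +-cong (coeff-scaledLift (a * b) g w k) (coeff-combination-rescale a gs w k) ⟩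
    (a * b) * φ (Q.coeff g w k) + a * coeff (combination gs) w k
      ≈⟨ +-cong (trans (*-assoc a b _) (*-congˡ (sym (coeff-scaledLift b g w k)))) refl ⟩
    a * coeff (scaledLift (b , g)) w k + a * coeff (combination gs) w k
      ≈⟨ sym (distribˡ a _ _) ⟩
    a * (coeff (scaledLift (b , g)) w k + coeff (combination gs) w k)
      ≈⟨ *-congˡ (sym (coeff-⊕ (scaledLift (b , g)) _ w k)) ⟩
    a * coeff (combination ((b , g) ∷ gs)) w k ∎

  tensor-respects : ∀ f g → f ≋ g → Tensor N f → Tensor N g
  tensor-respects f g f≋g (gs , gs∈N , f≋) = gs , gs∈N , λ w k → trans (sym (f≋g w k)) (f≋ w k)

  tensor-⊕ : ∀ f g → Tensor N f → Tensor N g → Tensor N (f ⊕ g)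
  tensor-⊕ f g (gs , gs∈N , f≋) (hs , hs∈N , g≋) = gs ++ hs , ++⁺ gs∈N hs∈N , λ w k → begin
    coeff (f ⊕ g) w k                                            ≈⟨ coeff-⊕ f g w k ⟩
    coeff f w k + coeff g w k                                    ≈⟨ +-cong (f≋ w k) (g≋ w k) ⟩
    coeff (combination gs) w k + coeff (combination hs) w k      ≈⟨ sym (coeff-combination-++ gs hs w k) ⟩
    coeff (combination (gs ++ hs)) w k                           ∎

  tensor-scale : ∀ a f → Tensor N f → Tensor N (monomial a 0 · f)
  tensor-scale a f (gs , gs∈N , f≋) = rescale a gs , map⁺ gs∈N , λ w k → begin
    coeff (monomial a 0 · f) w k                 ≈⟨ coeff-scale a f w k ⟩
    a * coeff f w k                              ≈⟨ *-congˡ (f≋ w k) ⟩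
    a * coeff (combination gs) w k               ≈⟨ sym (coeff-combination-rescale a gs w k) ⟩
    coeff (combination (rescale a gs)) w k       ∎

  tensor-lift : ∀ a {g} → N g → Tensor N (scaledLift (a , g))
  tensor-lift a {g} g∈N = (a , g) ∷ [] , g∈N ∷ [] , λ w k → sym (trans (coeff-⊕ (scaledLift (a , g)) [] w k) (+-identityʳ _))

  tensor-sumDown : ∀ h B → (∀ d → Tensor N (h d)) → Tensor N (sumNCt (applyDownFrom h B))
  tensor-sumDown h zero    h∈ = [] , [] , λ w k → refl
  tensor-sumDown h (suc B) h∈ = tensor-⊕ (h B) (sumNCt (applyDownFrom h B)) (h∈ B) (tensor-sumDown h B h∈)

  record ConstantInTensor (coeffs : Word → Carrier) : Set (c Level.⊔ ℓ Level.⊔ n) where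
    constructor constantInTensor
    field
      element      : NCt
      member       : Tensor N element
      constantPart : ∀ w → coeff element w 0 ≈ coeffs w
      isConstant   : IsConstant element

  -- Coefficient extraction passes to A ⊗ N: apply it to each gᵢ in Σᵢ aᵢ ⊗ gᵢ.
  combination-coefficient : ∀ gs → All (λ ag → N (proj₂ ag)) gs → ∀ d →
                            ConstantInTensor (λ w → coeff (combination gs) w d)
  combination-coefficient []             []              d = constantInTensor [] ([] , [] , λ w k → refl) (λ w → refl) (λ w k → refl)
  combination-coefficient ((a , g) ∷ gs) (g∈N ∷ gs∈N) d =
    let Extraction.constantIn cg cg∈N cg₀ cg-const = Extraction.coefficient-mem N DN g∈N d
        constantInTensor c c∈AN c₀ c-const       = combination-coefficient gs gs∈N d
    in  constantInTensor (scaledLift (a , cg) ⊕ c) (tensor-⊕ (scaledLift (a , cg)) c (tensor-lift a cg∈N) c∈AN)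
          (λ w → begin
            coeff (scaledLift (a , cg) ⊕ c) w 0              ≈⟨ coeff-⊕ (scaledLift (a , cg)) c w 0 ⟩
            coeff (scaledLift (a , cg)) w 0 + coeff c w 0    ≈⟨ +-cong (coeff-scaledLift a cg w 0) (c₀ w) ⟩
            a * φ (Q.coeff cg w 0) + coeff (combination gs) w d
                                                              ≈⟨ +-congʳ (*-congˡ (φ-cong (cg₀ w))) ⟩
            a * φ (Q.coeff g w d) + coeff (combination gs) w d ≈⟨ +-congʳ (sym (coeff-scaledLift a g w d)) ⟩
            coeff (scaledLift (a , g)) w d + coeff (combination gs) w d
                                                              ≈⟨ sym (coeff-⊕ (scaledLift (a , g)) _ w d) ⟩
            coeff (combination ((a , g) ∷ gs)) w d            ∎)
          (λ w k → begin
            coeff (scaledLift (a , cg) ⊕ c) w (suc k)              ≈⟨ coeff-⊕ (scaledLift (a , cg)) c w (suc k) ⟩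
            coeff (scaledLift (a , cg)) w (suc k) + coeff c w (suc k) ≈⟨ +-cong (coeff-scaledLift a cg w (suc k)) (c-const w k) ⟩
            a * φ (Q.coeff cg w (suc k)) + 0#                      ≈⟨ +-congʳ (trans (*-congˡ (φ-zero (cg-const w k))) (zeroʳ a)) ⟩
            0# + 0#                                                ≈⟨ +-identityʳ 0# ⟩
            0#                                                     ∎)

  tensor-coefficient : ∀ f → Tensor N f → ∀ d → ConstantInTensor (λ w → coeff f w d)
  tensor-coefficient f (gs , gs∈N , f≋) d =
    let constantInTensor c c∈AN c₀ c-const = combination-coefficient gs gs∈N d
    in  constantInTensor c c∈AN (λ w → trans (c₀ w) (sym (f≋ w d))) c-const

  module _ (α : Carrier) where

    -- N_α ⊂ A ⊗ N: if x = F(α) with F = Σₖ Fₖ tᵏ ∈ A ⊗ N, then x = Σₖ αᵏ Fₖ, and each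
    -- coefficient Fₖ lies in A ⊗ N as a constant.
    Nα⊆tensor : ∀ x → Nα N α x → Tensor N (const x)
    Nα⊆tensor x (F , F∈AN , x≋F[α]) = tensor-respects (sumNCt (applyDownFrom term B)) (const x) S≋x (tensor-sumDown term B term∈AN)
      where
      B = degreeBound F
      module Fₖ k = ConstantInTensor (tensor-coefficient F F∈AN k)
      term : ℕ → NCt
      term k = monomial (pow α k) 0 · Fₖ.element k
      term∈AN : ∀ k → Tensor N (term k)
      term∈AN k = tensor-scale (pow α k) (Fₖ.element k) (Fₖ.member k)
      S≋x : sumNCt (applyDownFrom term B) ≋ const x
      S≋x w zero = begin
        coeff (sumNCt (applyDownFrom term B)) w 0            ≈⟨ coeff-sumDown term B w 0 ⟩
        sumTo B (λ k → coeff (term k) w 0)                   ≈⟨ sumTo-cong B (λ k → coeff-scale (pow α k) (Fₖ.element k) w 0) ⟩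
        sumTo B (λ k → pow α k * coeff (Fₖ.element k) w 0)   ≈⟨ sumTo-cong B (λ k → *-congˡ (Fₖ.constantPart k w)) ⟩
        sumTo B (λ k → pow α k * coeff F w k)                ≈⟨ sym (coeff-eval α F B w ℕP.≤-refl) ⟩
        coeffNC (eval α F) w                                 ≈⟨ sym (x≋F[α] w) ⟩
        coeffNC x w                                          ≈⟨ sym (coeff-const-zero x w) ⟩
        coeff (const x) w 0                                  ∎
      S≋x w (suc k) = begin
        coeff (sumNCt (applyDownFrom term B)) w (suc k)      ≈⟨ coeff-sumDown term B w (suc k) ⟩
        sumTo B (λ d → coeff (term d) w (suc k))             ≈⟨ sumTo-zero B higherTerm ⟩
        0#                                                   ≈⟨ sym (const-isConstant x w k) ⟩
        coeff (const x) w (suc k)                            ∎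
        where
        higherTerm : ∀ d → coeff (term d) w (suc k) ≈ 0#
        higherTerm d = trans (coeff-scale (pow α d) (Fₖ.element d) w (suc k))
                             (trans (*-congˡ (Fₖ.isConstant d w k)) (zeroʳ _))

    -- A ⊗ N is spanned over A[t] by N_α: f = Σ_(d<B) tᵈ · Fd(α), where the constant Fd ∈ A ⊗ N
    -- carrying the coefficient of tᵈ in f satisfies Fd(α) = Fd ∈ N_α.
    tensor-spannedBy-Nα : ∀ f → Tensor N f →
      Σ (List (Pol × NC)) λ gs → All (λ px → Nα N α (proj₂ px)) gs ×
                                 (f ≋ sumNCt (map (λ px → proj₁ px · const (proj₂ px)) gs))
    tensor-spannedBy-Nα f f∈AN = applyDownFrom generator B , applyDownFrom⁺₂ generator B generator∈Nα , f≋
      where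
      B = degreeBound f
      module fₖ k = ConstantInTensor (tensor-coefficient f f∈AN k)
      generator : ℕ → Pol × NC
      generator d = monomial 1# d , eval α (fₖ.element d)
      generator∈Nα : ∀ d → Nα N α (proj₂ (generator d))
      generator∈Nα d = fₖ.element d , fₖ.member d , λ w → refl
      summand : ℕ → NCt
      summand d = monomial 1# d · const (eval α (fₖ.element d))
      summand-hit : ∀ w k → coeff (summand k) w k ≈ coeff f w k
      summand-hit w k = begin
        coeff (summand k) w k                     ≈⟨ coeff-monomial-const-hit 1# k (eval α (fₖ.element k)) w ⟩
        1# * coeffNC (eval α (fₖ.element k)) w    ≈⟨ *-identityˡ _ ⟩
        coeffNC (eval α (fₖ.element k)) w         ≈⟨ eval-constant α (fₖ.element k) w (fₖ.isConstant k) ⟩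
        coeff (fₖ.element k) w 0                  ≈⟨ fₖ.constantPart k w ⟩
        coeff f w k                               ∎
      sumOfSummands : ∀ w k → Dec (k < B) → coeff f w k ≈ sumTo B (λ d → coeff (summand d) w k)
      sumOfSummands w k (yes k<B) =
        sym (trans (sumTo-single B k (λ d d≢k → coeff-monomial-const-miss 1# d (eval α (fₖ.element d)) w k d≢k) k<B) (summand-hit w k))
      sumOfSummands w k (no k≮B)  =
        trans (coeff-degreeBound f w k (ℕP.≮⇒≥ k≮B))
              (sym (sumTo-outside B k (λ d d≢k → coeff-monomial-const-miss 1# d (eval α (fₖ.element d)) w k d≢k) (ℕP.≮⇒≥ k≮B)))
      f≋ : f ≋ sumNCt (map (λ px → proj₁ px · const (proj₂ px)) (applyDownFrom generator B))
      f≋ w k = begin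
        coeff f w k                                   ≈⟨ sumOfSummands w k (k ℕ.<? B) ⟩
        sumTo B (λ d → coeff (summand d) w k)         ≈⟨ sym (coeff-sumDown summand B w k) ⟩
        coeff (sumNCt (applyDownFrom summand B)) w k  ≡⟨ P.cong (λ gs → coeff (sumNCt gs) w k) (P.sym (map-applyDownFrom generator _ B)) ⟩
        coeff (sumNCt (map (λ px → proj₁ px · const (proj₂ px)) (applyDownFrom generator B))) w k ∎

lemma5p1 : ∀ {n} (N : Q.NCt → Set n) → IsDiffSubmodule N →
    ∀ {c ℓ} (A : CommutativeRing c ℓ) (φ : ℚ → CommutativeRing.Carrier A) → IsQAlgebraStr A φ →
    (α : CommutativeRing.Carrier A) →
    Poly.GeneratedBy A (Base.Nα A φ N α) (Base.Tensor A φ N)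
lemma5p1 N N-diff A φ φ-hom α = Nα⊆tensor α , tensor-spannedBy-Nα α
  where open BaseChange N N-diff A φ φ-hom
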